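{- Let $u,w\in\widetilde{A}_n$ and suppose $k_u(i,j)\ge0$ and $k_w(i,j)\ge0$ for all $(i,j)\in\Phi^+$. Then $u\le w$ in the weak order on $\widetilde{A}_n$ if and only if $k_u(i,j)\le k_w(i,j)$ for all $(i,j)\in\Phi^+$.
   Context: Let $\epsilon_1,\dots,\epsilon_{n+1}$ be the standard basis of $\mathbb{R}^{n+1}$, $V=\{\lambda:(\lambda,\epsilon_1+\cdots+\epsilon_{n+1})=0\}$, $\Phi^+=\{(i,j):1\le i<j\le n+1\}$. For $a\in\mathbb{Z}$, $H_{ij}^a=\{\lambda\in V:(\lambda,\epsilon_i-\epsilon_j)=a\}$; alcoves are the connected components of the complement of all these hyperplanes. The address of an alcove $\mathcal{A}$ is $k_{\mathcal{A}}:\Phi^+\to\mathbb{Z}$ with $k_{\mathcal{A}}(i,j)<(\lambda,\epsilon_i-\epsilon_j)<k_{\mathcal{A}}(i,j)+1$ on $\mathcal{A}$; the fundamental alcove $\mathcal{A}_\circ$ has address $0$. The affine Weyl group $\widetilde{A}_n$ is generated by reflections in all $H_{ij}^a$, acts simply transitively on alcoves, and is a Coxeter group with generators the reflections $s_1,\dots,s_n$ in $H_{i,i+1}^0$ and $s_{n+1}$ in $H_{1,n+1}^1$. For $w\in\widetilde{A}_n$, $k_w$ is the address of $w(\mathcal{A}_\circ)$. Length $\ell$ is with respect to these generators; the weak order is the transitive closure of $w\to ws$ for generators $s$ with $\ell(ws)>\ell(w)$. -}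

module Defs where

open import Data.Nat as ℕ using (ℕ; zero; suc)
open import Data.Integer as ℤ using (ℤ; +_; _-_; _*_; _+_)
open import Data.Integer.DivMod using (_/ℕ_)
open import Data.Fin as Fin using (Fin; toℕ; inject₁; fromℕ; _≟_)
open import Data.List using (List; []; _∷_; _++_; [_]; length)
open import Data.Product using (Σ; _×_; ∃)
open import Relation.Nullary using (yes; no)
open import Relation.Binary.PropositionalEquality using (_≡_)
open import Relation.Binary.Construct.Closure.ReflexiveTransitive using (Star)

-- Throughout, N = n+1 is the ambient dimension; Fin (suc n) indexes ε₁,…,ε_{n+1}
-- (index k : Fin (suc n) stands for ε_{k+1}).

-- Points of V, scaled by the factor 2N (so that all points we use are integral).
-- A scaled point μ represents λ = μ / (2N).
Point : ℕ → Set
Point n = Fin (suc n) → ℤ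

δ : ∀ {n} → Fin n → Fin n → ℤ
δ k i with k ≟ i
... | yes _ = + 1
... | no  _ = + 0

twoN : ℕ → ℕ
twoN n = 2 ℕ.* suc n

-- Reflection in the hyperplane H_{ij}^a, written for scaled points μ = 2N·λ:
--   λ ↦ λ - ((λ, εᵢ - εⱼ) - a)(εᵢ - εⱼ)   becomes
--   μ ↦ μ - ((μ, εᵢ - εⱼ) - 2N·a)(εᵢ - εⱼ).
reflH : ∀ {n} → Fin (suc n) → Fin (suc n) → ℤ → Point n → Point n
reflH {n} i j a μ k = μ k - (((μ i - μ j) - + twoN n * a) * (δ k i - δ k j))

-- Coxeter generators: simple k = s_{k+1} (k = 0,…,n-1), reflection in H_{k+1,k+2}^0;
-- affine = s_{n+1}, reflection in H_{1,n+1}^1.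
data Gen (n : ℕ) : Set where
  simple : Fin n → Gen n
  affine : Gen n

genAct : ∀ {n} → Gen n → Point n → Point n
genAct (simple k) = reflH (inject₁ k) (Fin.suc k) (+ 0)
genAct {n} affine = reflH Fin.zero (fromℕ n) (+ 1)

Word : ℕ → Set
Word n = List (Gen n)

act : ∀ {n} → Word n → Point n → Point n
act []       μ = μ
act (s ∷ w)  μ = genAct s (act w μ)

-- A fixed interior point of the fundamental alcove A∘:
-- λ₀ = (N+1-2i)/(2N) for i = 1..N, i.e. scaled μ₀(k) = N - 1 - 2k.
-- It satisfies 0 < (λ₀, εᵢ - εⱼ) = (j-i)/N < 1 for i < j.
μ₀ : (n : ℕ) → Point n
μ₀ n k = + n - + (2 ℕ.* toℕ k)

-- Elements of Ã_n are words modulo equality in the group; since Ã_n acts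
-- simply transitively on alcoves (and the stabiliser of an interior point of
-- A∘ is trivial), two words give the same element iff they send μ₀ to the
-- same point.
_≈W_ : ∀ {n} → Word n → Word n → Set
_≈W_ {n} u v = ∀ k → act u (μ₀ n) k ≡ act v (μ₀ n) k

-- Address k_w(i,j): the integer with k < (λ, εᵢ - εⱼ) < k+1 on w(A∘),
-- computed at the interior point w(λ₀): floor((μᵢ - μⱼ)/(2N)).
address : ∀ {n} → Word n → Fin (suc n) → Fin (suc n) → ℤ
address {n} w i j = (act w (μ₀ n) i - act w (μ₀ n) j) /ℕ twoN n

IsLength : ∀ {n} → Word n → ℕ → Set
IsLength {n} w m =
  (Σ (Word n) λ v → (v ≈W w) × (length v ≡ m)) ×
  (∀ (v : Word n) → v ≈W w → m ℕ.≤ length v)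

LengthLt : ∀ {n} → Word n → Word n → Set
LengthLt u v = Σ ℕ λ m → Σ ℕ λ m' → IsLength u m × IsLength v m' × (m ℕ.< m')

WeakStep : ∀ {n} → Word n → Word n → Set
WeakStep {n} w v = Σ (Gen n) λ s → (v ≈W (w ++ [ s ])) × LengthLt w v

-- Weak order: reflexive–transitive closure of the steps, on group elements
-- (the final word only needs to represent the same element).
_≤W_ : ∀ {n} → Word n → Word n → Set
_≤W_ {n} u w = Σ (Word n) λ v → Star WeakStep u v × (v ≈W w)

module Submission where

-- Encode an element w of Ã_n by its window: a permutation σ_w of the coordinates and an integer
-- vector t_w with w(μ) = μ ∘ σ_w + 2N·t_w.  Then k_w(i,j) = t_w(i) − t_w(j) − [σ_w(j) < σ_w(i)], and
-- appending a generator s changes k_w only on the pair (X,Y) = σ_w⁻¹(wall of s): by −1 at (X,Y) and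
-- by +1 at (Y,X).  Hence Σ_{i<j} |k_w(i,j)| changes by ±1 at each step and is the length, and along the
-- weak order positive addresses never decrease, which gives (⇒).  For (⇐), induct on ℓ(w): if some
-- wall (X,Y) of w(A∘) with X < Y has k_u(X,Y) < k_w(X,Y), crossing it shortens w and keeps k_u ≤ k_{ws}.
-- Otherwise u(A∘) lies on the same side as w(A∘) of every wall of w(A∘); then the coordinates of
-- u(λ₀) − w(λ₀) weakly decrease around the cycle of walls, hence are constant, and as both points lie
-- in V, u = w.

open import Defs
open import Data.Nat using (ℕ; suc)
open import Data.Integer using (+_) renaming (_≤_ to _≤ℤ_)
open import Data.Fin using (Fin) renaming (_<_ to _<F_)
open import Function.Bundles using (_⇔_; mk⇔)

open import Data.Nat as ℕ using (zero)
import Data.Nat.Properties as ℕP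
open import Data.Integer as ℤ using (ℤ; -[1+_]; _-_; _*_; _+_; -_)
import Data.Integer.Properties as ℤP
open import Data.Integer.Tactic.RingSolver using (solve-∀)
open import Data.Integer.DivMod using (_/ℕ_; _%ℕ_; a≡a%ℕn+[a/ℕn]*n; n%ℕd<d)
open import Data.Fin as Fin using (zero; suc; toℕ; inject₁; fromℕ; _≟_)
import Data.Fin.Properties as FinP
open import Data.Fin.Permutation.Components using (transpose)
open import Data.List using (List; []; _∷_; _++_; [_]; length)
import Data.List.Properties as DataListP
open import Data.List.Reverse using (Reverse; reverseView; []; _∶_∶ʳ_)
open import Data.Product using (Σ; _×_; _,_; proj₁; proj₂)
open import Data.Sum using (_⊎_; inj₁; inj₂)
open import Data.Empty using (⊥-elim)
open import Relation.Binary.Construct.Closure.ReflexiveTransitive using (Star; ε; _◅_; _◅◅_)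
open import Relation.Nullary using (Dec; yes; no; ¬_; does)
open import Data.Bool using (if_then_else_)
open import Relation.Binary.Definitions using (tri<; tri≈; tri>)
open import Relation.Nullary.Decidable using (dec-true; dec-false; _×-dec_)
open import Relation.Binary.PropositionalEquality hiding ([_])
open import Function.Base using (_∘_)
import Algebra.Properties.Semiring.Sum as SemiringSum
open import Algebra.Properties.AbelianGroup ℤP.+-0-abelianGroup using (∙-cancelˡ; ∙-cancelʳ)

module Σℤ = SemiringSum ℤP.+-*-semiring
module Σℕ = SemiringSum ℕP.+-*-semiring
open Σℤ using (sum)

δ-diag : ∀ {k} (x : Fin k) → δ x x ≡ + 1
δ-diag x with x ≟ x
... | yes _   = refl
... | no  x≢x = ⊥-elim (x≢x refl)

δ-off : ∀ {k} {x y : Fin k} → x ≢ y → δ x y ≡ + 0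
δ-off {x = x} {y} x≢y with x ≟ y
... | yes x≡y = ⊥-elim (x≢y x≡y)
... | no  _   = refl

inject₁<suc : ∀ {k} (a : Fin k) → inject₁ a Fin.< suc a
inject₁<suc a = ℕ.s≤s (ℕP.≤-reflexive (FinP.toℕ-inject₁ a))

inject₁≢suc : ∀ {k} (a : Fin k) → inject₁ a ≢ suc a
inject₁≢suc a eq = ℕP.1+n≢n (sym (trans (sym (FinP.toℕ-inject₁ a)) (cong toℕ eq)))

data Side {k} (a b x : Fin k) : Set where
  at₁ : x ≡ a → Side a b x
  at₂ : x ≡ b → Side a b x
  off : x ≢ a → x ≢ b → Side a b x

side : ∀ {k} (a b x : Fin k) → Side a b x
side a b x with x ≟ a | x ≟ b
... | yes x≡a | _       = at₁ x≡a
... | no  _   | yes x≡b = at₂ x≡b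
... | no  x≢a | no  x≢b = off x≢a x≢b

transpose-at₁ : ∀ {k} (a b : Fin k) → transpose a b a ≡ b
transpose-at₁ a b rewrite dec-true (a ≟ a) refl = refl

transpose-at₂ : ∀ {k} (a b : Fin k) → transpose a b b ≡ a
transpose-at₂ a b with b ≟ a
... | yes refl = refl
... | no  b≢a rewrite dec-true (b ≟ b) refl = refl

transpose-off : ∀ {k} {a b x : Fin k} → x ≢ a → x ≢ b → transpose a b x ≡ x
transpose-off {a = a} {b} {x} x≢a x≢b rewrite dec-false (x ≟ a) x≢a | dec-false (x ≟ b) x≢b = refl

transpose-involutive : ∀ {k} (a b x : Fin k) → transpose a b (transpose a b x) ≡ x
transpose-involutive a b x with side a b x
... | at₁ refl = trans (cong (transpose x b) (transpose-at₁ x b)) (transpose-at₂ x b)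
... | at₂ refl = trans (cong (transpose a x) (transpose-at₂ a x)) (transpose-at₁ a x)
... | off x≢a x≢b = trans (cong (transpose a b) (transpose-off x≢a x≢b)) (transpose-off x≢a x≢b)

-- Finite sums

sum-zero : ∀ {k} (f : Fin k → ℤ) → (∀ i → f i ≡ + 0) → sum f ≡ + 0
sum-zero {k} f f≡0 = trans (Σℤ.sum-cong-≗ f≡0) (Σℤ.sum-replicate-zero k)

sum-support₁ : ∀ {k} (f : Fin k → ℤ) p → (∀ i → i ≢ p → f i ≡ + 0) → sum f ≡ f p
sum-support₁ f zero f≡0 = trans (cong (_+_ (f zero)) (sum-zero _ (λ i → f≡0 (suc i) λ ()))) (ℤP.+-identityʳ _)
sum-support₁ f (suc p) f≡0 =
  trans (cong₂ _+_ (f≡0 zero λ ()) (sum-support₁ (f ∘ suc) p (λ i i≢p → f≡0 (suc i) (i≢p ∘ FinP.suc-injective))))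
        (ℤP.+-identityˡ _)

sum-support₂ : ∀ {k} (f : Fin k → ℤ) p q → p ≢ q → (∀ i → i ≢ p → i ≢ q → f i ≡ + 0) → sum f ≡ f p + f q
sum-support₂ f zero zero p≢q _ = ⊥-elim (p≢q refl)
sum-support₂ f zero (suc q) _ f≡0 =
  cong (_+_ (f zero)) (sum-support₁ (f ∘ suc) q (λ i i≢q → f≡0 (suc i) (λ ()) (i≢q ∘ FinP.suc-injective)))
sum-support₂ f (suc p) zero _ f≡0 =
  trans (cong (_+_ (f zero)) (sum-support₁ (f ∘ suc) p (λ i i≢p → f≡0 (suc i) (i≢p ∘ FinP.suc-injective) (λ ()))))
        (ℤP.+-comm (f zero) (f (suc p)))
sum-support₂ f (suc p) (suc q) p≢q f≡0 =
  trans (cong₂ _+_ (f≡0 zero (λ ()) (λ ()))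
                   (sum-support₂ (f ∘ suc) p q (p≢q ∘ cong suc)
                      (λ i i≢p i≢q → f≡0 (suc i) (i≢p ∘ FinP.suc-injective) (i≢q ∘ FinP.suc-injective))))
        (ℤP.+-identityˡ _)

sum-neg : ∀ {k} (f : Fin k → ℤ) → sum (λ i → - f i) ≡ - sum f
sum-neg {zero}  f = refl
sum-neg {suc k} f = trans (cong (_+_ (- f zero)) (sum-neg (f ∘ suc))) (sym (ℤP.neg-distrib-+ (f zero) (sum (f ∘ suc))))

sum-sub : ∀ {k} (f g : Fin k → ℤ) → sum (λ i → f i - g i) ≡ sum f - sum g
sum-sub f g = trans (Σℤ.∑-distrib-+ f (λ i → - g i)) (cong (_+_ (sum f)) (sum-neg g))

sum-const : ∀ k (κ : ℤ) → sum {k} (λ _ → κ) ≡ + k * κ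
sum-const zero    κ = refl
sum-const (suc k) κ = trans (cong (_+_ κ) (sum-const k κ)) (sym (ℤP.suc-* (+ k) κ))

sum-pos : ∀ {k} (f : Fin k → ℕ) → sum (λ i → + f i) ≡ + Σℕ.sum f
sum-pos {zero}  f = refl
sum-pos {suc k} f = trans (cong (_+_ (+ f zero)) (sum-pos (f ∘ suc))) (sym (ℤP.pos-+ (f zero) (Σℕ.sum (f ∘ suc))))

sum-δ : ∀ {k} (p : Fin k) → sum (λ i → δ i p) ≡ + 1
sum-δ p = trans (sum-support₁ _ p (λ _ → δ-off)) (δ-diag p)

sum₂-support : ∀ {k} (d : Fin k → Fin k → ℤ) {p q} → p ≢ q →
               (∀ i j → ¬ (i ≡ p × j ≡ q) → ¬ (i ≡ q × j ≡ p) → d i j ≡ + 0) →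
               sum (λ i → sum (d i)) ≡ d p q + d q p
sum₂-support d {p} {q} p≢q d≡0 = trans (sum-support₂ _ p q p≢q other-row) (cong₂ _+_ row-p row-q)
  where
  other-row : ∀ i → i ≢ p → i ≢ q → sum (d i) ≡ + 0
  other-row i i≢p i≢q = sum-zero (d i) (λ j → d≡0 i j (i≢p ∘ proj₁) (i≢q ∘ proj₁))
  row-p : sum (d p) ≡ d p q
  row-p = sum-support₁ (d p) q (λ j j≢q → d≡0 p j (j≢q ∘ proj₂) (p≢q ∘ proj₁))
  row-q : sum (d q) ≡ d q p
  row-q = sum-support₁ (d q) p (λ j j≢p → d≡0 q j (p≢q ∘ sym ∘ proj₁) (j≢p ∘ proj₂))

sum₂-pos : ∀ {k} (f : Fin k → Fin k → ℕ) → sum (λ i → sum (λ j → + f i j)) ≡ + Σℕ.sum (λ i → Σℕ.sum (f i))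
sum₂-pos f = trans (Σℤ.sum-cong-≗ (λ i → sum-pos (f i))) (sum-pos (λ i → Σℕ.sum (f i)))

sum₂-sub : ∀ {k} (f g : Fin k → Fin k → ℤ) →
           sum (λ i → sum (λ j → f i j - g i j)) ≡ sum (λ i → sum (f i)) - sum (λ i → sum (g i))
sum₂-sub f g = trans (Σℤ.sum-cong-≗ (λ i → sum-sub (f i) (g i))) (sum-sub (λ i → sum (f i)) (λ i → sum (g i)))

sum₂-update : ∀ {k} (f g : Fin k → Fin k → ℕ) {p q} → p ≢ q →
              (∀ i j → ¬ (i ≡ p × j ≡ q) → ¬ (i ≡ q × j ≡ p) → f i j ≡ g i j) →
              Σℕ.sum (λ i → Σℕ.sum (f i)) ℕ.+ (g p q ℕ.+ g q p)
                ≡ Σℕ.sum (λ i → Σℕ.sum (g i)) ℕ.+ (f p q ℕ.+ f q p)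
sum₂-update f g {p} {q} p≢q f≡g = ℤP.+-injective (begin
  + (F ℕ.+ (g p q ℕ.+ g q p))                    ≡⟨ pos-+₃ F (g p q) (g q p) ⟩
  + F + (+ g p q + + g q p)                       ≡⟨ cong (λ z → z + (+ g p q + + g q p)) F≡G+d ⟩
  + G + (d p q + d q p) + (+ g p q + + g q p)     ≡⟨ collect (+ G) (+ f p q) (+ g p q) (+ f q p) (+ g q p) ⟩
  + G + (+ f p q + + f q p)                       ≡⟨ pos-+₃ G (f p q) (f q p) ⟨
  + (G ℕ.+ (f p q ℕ.+ f q p))                    ∎)
  where
  open ≡-Reasoning
  F = Σℕ.sum (λ i → Σℕ.sum (f i))
  G = Σℕ.sum (λ i → Σℕ.sum (g i))
  d : Fin _ → Fin _ → ℤ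
  d i j = + f i j - + g i j
  d≡0 : ∀ i j → ¬ (i ≡ p × j ≡ q) → ¬ (i ≡ q × j ≡ p) → d i j ≡ + 0
  d≡0 i j ≢pq ≢qp = trans (cong (λ z → + z - + g i j) (f≡g i j ≢pq ≢qp)) (ℤP.+-inverseʳ (+ g i j))
  F-G : + F - + G ≡ d p q + d q p
  F-G = begin
    + F - + G
      ≡⟨ cong₂ _-_ (sum₂-pos f) (sum₂-pos g) ⟨
    sum (λ i → sum (λ j → + f i j)) - sum (λ i → sum (λ j → + g i j))
      ≡⟨ sum₂-sub (λ i j → + f i j) (λ i j → + g i j) ⟨
    sum (λ i → sum (d i))
      ≡⟨ sum₂-support d p≢q d≡0 ⟩
    d p q + d q p ∎
  F≡G+d : + F ≡ + G + (d p q + d q p)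
  F≡G+d = trans (add-back (+ F) (+ G)) (cong (_+_ (+ G)) F-G)
    where
    add-back : ∀ a b → a ≡ b + (a - b)
    add-back = solve-∀
  pos-+₃ : ∀ a b c → + (a ℕ.+ (b ℕ.+ c)) ≡ + a + (+ b + + c)
  pos-+₃ a b c = trans (ℤP.pos-+ a (b ℕ.+ c)) (cong (_+_ (+ a)) (ℤP.pos-+ b c))
  collect : ∀ G a b c d → G + ((a - b) + (c - d)) + (b + d) ≡ G + (a + c)
  collect = solve-∀

translate-sum-invariant : ∀ {k} (P : Fin (suc k) → ℤ) κ → sum (λ i → P i + κ) ≡ sum P → κ ≡ + 0
translate-sum-invariant {k} P κ eq = ℤP.*-cancelˡ-≡ (+ suc k) κ (+ 0) (trans (∙-cancelˡ (sum P) _ _ (begin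
  sum P + + suc k * κ          ≡⟨ cong (_+_ (sum P)) (sym (sum-const (suc k) κ)) ⟩
  sum P + sum {suc k} (λ _ → κ) ≡⟨ sym (Σℤ.∑-distrib-+ P (λ _ → κ)) ⟩
  sum (λ i → P i + κ)          ≡⟨ eq ⟩
  sum P                        ≡⟨ sym (ℤP.+-identityʳ (sum P)) ⟩
  sum P + + 0                  ∎)) (sym (ℤP.*-zeroʳ (+ suc k))))
  where open ≡-Reasoning

posPart : ℤ → ℕ
posPart (+ k)    = k
posPart -[1+ _ ] = 0

posPart-pair : ∀ z → posPart z ℕ.+ posPart (- z) ≡ ℤ.∣ z ∣
posPart-pair (+ zero)  = refl
posPart-pair (+ suc k) = ℕP.+-identityʳ (suc k)
posPart-pair -[1+ k ]  = refl

∣e-1∣-descent : ∀ {a b} e → + 1 ℤ.≤ e → a ℕ.+ ℤ.∣ e ∣ ≡ b ℕ.+ ℤ.∣ e - + 1 ∣ → suc a ≡ b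
∣e-1∣-descent {a} (+ suc k) _ eq = ℕP.+-cancelʳ-≡ k _ _ (trans (sym (ℕP.+-suc a k)) eq)
∣e-1∣-descent     (+ zero)  (ℤ.+≤+ ())

∣e-1∣-ascent : ∀ {a b} e → e ℤ.≤ + 0 → a ℕ.+ ℤ.∣ e ∣ ≡ b ℕ.+ ℤ.∣ e - + 1 ∣ → a ≡ suc b
∣e-1∣-ascent {a} {b} (+ zero)  _ eq = trans (sym (ℕP.+-identityʳ a)) (trans eq (ℕP.+-comm b 1))
∣e-1∣-ascent {a} {b} -[1+ k ]  _ eq =
  ℕP.+-cancelʳ-≡ (suc k) _ _
    (trans eq (trans (ℕP.+-suc b (suc (k ℕ.+ 0))) (cong (λ z → suc (b ℕ.+ suc z)) (ℕP.+-identityʳ k))))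
∣e-1∣-ascent         (+ suc k) (ℤ.+≤+ ())

-‿swap-≤ : ∀ a b c d → c - d ℤ.≤ a - b → b - d ℤ.≤ a - c
-‿swap-≤ a b c d le = subst₂ ℤ._≤_ (regroup c d b) (regroup′ a b c) (ℤP.+-monoˡ-≤ (b - c) le)
  where
  regroup : ∀ c d b → (c - d) + (b - c) ≡ b - d
  regroup = solve-∀
  regroup′ : ∀ a b c → (a - b) + (b - c) ≡ a - c
  regroup′ = solve-∀

≰1⇒≤0 : ∀ {e} → ¬ (+ 1 ℤ.≤ e) → e ℤ.≤ + 0
≰1⇒≤0 {+ zero}  _   = ℤP.≤-refl
≰1⇒≤0 {+ suc _} 1≰e = ⊥-elim (1≰e (ℤ.+≤+ (ℕ.s≤s ℕ.z≤n)))
≰1⇒≤0 { -[1+ _ ]} _ = ℤ.-≤+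

+≤0⇒≤- : ∀ {a c} → a + c ℤ.≤ + 0 → a ℤ.≤ - c
+≤0⇒≤- {a} {c} le = subst₂ ℤ._≤_ (cancel a c) (ℤP.+-identityˡ (- c)) (ℤP.+-monoˡ-≤ (- c) le)
  where
  cancel : ∀ a c → (a + c) - c ≡ a
  cancel = solve-∀

<⇒≤pred : ∀ {a b} → a ℤ.< b → a ℤ.≤ b - + 1
<⇒≤pred {a} {b} a<b = subst (ℤ._≤ b - + 1) (cancel a) (ℤP.+-monoˡ-≤ (- + 1) (ℤP.i<j⇒suc[i]≤j a<b))
  where
  cancel : ∀ a → + 1 + a - + 1 ≡ a
  cancel = solve-∀

pos-difference : ∀ k g x y c → g ℕ.+ x ≡ y ℕ.+ c → (+ k - + x) - (+ k - + y) ≡ + g - + c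
pos-difference k g x y c eq = begin
  (+ k - + x) - (+ k - + y) ≡⟨ regroup (+ k) (+ x) (+ y) (+ c) ⟩
  (+ y + + c) - + x - + c   ≡⟨ cong (λ z → z - + x - + c) y+c≡g+x ⟩
  (+ g + + x) - + x - + c   ≡⟨ cancel (+ g) (+ x) (+ c) ⟩
  + g - + c                 ∎
  where
  open ≡-Reasoning
  y+c≡g+x : + y + + c ≡ + g + + x
  y+c≡g+x = trans (sym (ℤP.pos-+ y c)) (trans (cong +_ (sym eq)) (ℤP.pos-+ g x))
  regroup : ∀ k x y c → (k - x) - (k - y) ≡ (y + c) - x - c
  regroup = solve-∀
  cancel : ∀ g x c → (g + x) - x - c ≡ g - c
  cancel = solve-∀

[r+q*d]/ℕd≡q : ∀ {d} .{{_ : ℕ.NonZero d}} {x q} r → r ℕ.< d → x ≡ + r + q * + d → x /ℕ d ≡ q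
[r+q*d]/ℕd≡q {d} {x} {q} r r<d x≡ = ℤP.≤-antisym (quotient-≤ (below _ q′ q′-split) (above r q r<d x≡))
                                                  (quotient-≤ (below r q x≡) (above _ q′ q′-rem< q′-split))
  where
  q′ = x /ℕ d
  q′-split : x ≡ + (x %ℕ d) + (x /ℕ d) * + d
  q′-split = a≡a%ℕn+[a/ℕn]*n x d
  q′-rem< : x %ℕ d ℕ.< d
  q′-rem< = n%ℕd<d x d
  below : ∀ r q → x ≡ + r + q * + d → q * + d ℤ.≤ x
  below r q x≡ = subst (q * + d ℤ.≤_) (trans (ℤP.+-comm (q * + d) (+ r)) (sym x≡)) (ℤP.i≤i+j (q * + d) (+ r))
  above : ∀ r q → r ℕ.< d → x ≡ + r + q * + d → x ℤ.< (+ 1 + q) * + d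
  above r q r<d x≡ = subst₂ ℤ._<_ (sym x≡) (sym (ℤP.suc-* q (+ d))) (ℤP.+-monoˡ-< (q * + d) (ℤ.+<+ r<d))
  quotient-≤ : ∀ {a b} → a * + d ℤ.≤ x → x ℤ.< (+ 1 + b) * + d → a ℤ.≤ b
  quotient-≤ {a} {b} a*d≤x x<[1+b]*d =
    ℤP.≮⇒≥ λ b<a → ℤP.<⇒≱ (ℤP.*-cancelʳ-<-nonNeg (+ d) (ℤP.≤-<-trans a*d≤x x<[1+b]*d)) (ℤP.i<j⇒suc[i]≤j b<a)

descending-≤-head : ∀ {k} (h : Fin (suc k) → ℤ) → (∀ a → h (suc a) ℤ.≤ h (inject₁ a)) → ∀ b → h b ℤ.≤ h zero
descending-≤-head h desc zero = ℤP.≤-refl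
descending-≤-head {suc k} h desc (suc b) = ℤP.≤-trans (descending-≤-head (h ∘ suc) (desc ∘ suc) b) (desc zero)

descending-last-≤ : ∀ {k} (h : Fin (suc k) → ℤ) → (∀ a → h (suc a) ℤ.≤ h (inject₁ a)) →
                    ∀ b → h (fromℕ k) ℤ.≤ h b
descending-last-≤ {zero}  h desc zero    = ℤP.≤-refl
descending-last-≤ {suc k} h desc zero    = ℤP.≤-trans (descending-last-≤ (h ∘ suc) (desc ∘ suc) zero) (desc zero)
descending-last-≤ {suc k} h desc (suc b) = descending-last-≤ (h ∘ suc) (desc ∘ suc) b

cycle-constant : ∀ {k} (h : Fin (suc k) → ℤ) → (∀ a → h (suc a) ℤ.≤ h (inject₁ a)) → h zero ℤ.≤ h (fromℕ k) →
                 ∀ b → h b ≡ h zero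
cycle-constant h desc wrap b = ℤP.≤-antisym (descending-≤-head h desc b)
  (ℤP.≤-trans wrap (descending-last-≤ h desc b))

reflH-transpose : ∀ {n} {i j : Fin (suc n)} (a : ℤ) (μ : Point n) k → i ≢ j →
                  reflH i j a μ k ≡ μ (transpose i j k) + + twoN n * (a * (δ k i - δ k j))
reflH-transpose {n} {i} {j} a μ k i≢j with side i j k
... | at₁ refl rewrite δ-diag k | δ-off i≢j | transpose-at₁ k j = reflected (μ k) (μ j) (+ twoN n) a
  where
  reflected : ∀ x y d a → x - ((x - y - d * a) * (+ 1 - + 0)) ≡ y + d * (a * (+ 1 - + 0))
  reflected = solve-∀
... | at₂ refl rewrite δ-diag k | δ-off (i≢j ∘ sym) | transpose-at₂ i k = reflected (μ i) (μ k) (+ twoN n) a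
  where
  reflected : ∀ x y d a → y - ((x - y - d * a) * (+ 0 - + 1)) ≡ x + d * (a * (+ 0 - + 1))
  reflected = solve-∀
... | off k≢i k≢j rewrite δ-off k≢i | δ-off k≢j | transpose-off k≢i k≢j =
  fixed (μ k) (μ i - μ j - + twoN n * a) (+ twoN n) a
  where
  fixed : ∀ x c d a → x - c * (+ 0 - + 0) ≡ x + d * (a * (+ 0 - + 0))
  fixed = solve-∀

reflH-involutive : ∀ {n} {i j : Fin (suc n)} a (μ : Point n) k → i ≢ j → reflH i j a (reflH i j a μ) k ≡ μ k
reflH-involutive {n} {i} {j} a μ k i≢j
  rewrite δ-diag i | δ-diag j | δ-off i≢j | δ-off (i≢j ∘ sym) = cancel (μ k) (μ i) (μ j) (+ twoN n) a (δ k i) (δ k j)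
  where
  cancel : ∀ x p q d a e f →
           (x - (p - q - d * a) * (e - f))
             - ((p - (p - q - d * a) * (+ 1 - + 0)) - (q - (p - q - d * a) * (+ 0 - + 1)) - d * a) * (e - f) ≡ x
  cancel = solve-∀

sum-reflH : ∀ {n} (i j : Fin (suc n)) a (μ : Point n) → sum (reflH i j a μ) ≡ sum μ
sum-reflH {n} i j a μ = begin
  sum (λ k → μ k - c * (δ k i - δ k j))           ≡⟨ sum-sub μ (λ k → c * (δ k i - δ k j)) ⟩
  sum μ - sum (λ k → c * (δ k i - δ k j))
    ≡⟨ cong (λ z → sum μ - z) (Σℤ.*-distribˡ-sum c (λ k → δ k i - δ k j)) ⟨
  sum μ - c * sum (λ k → δ k i - δ k j)
    ≡⟨ cong (λ z → sum μ - c * z) (sum-sub (λ k → δ k i) (λ k → δ k j)) ⟩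
  sum μ - c * (sum (λ k → δ k i) - sum (λ k → δ k j)) ≡⟨ cong₂ (λ x y → sum μ - c * (x - y)) (sum-δ i) (sum-δ j) ⟩
  sum μ - c * (+ 1 - + 1)                         ≡⟨ cancel (sum μ) c ⟩
  sum μ                                           ∎
  where
  open ≡-Reasoning
  c = μ i - μ j - + twoN n * a
  cancel : ∀ x c → x - c * (+ 1 - + 1) ≡ x
  cancel = solve-∀

gen-search : ∀ {n} (P : Gen n → Set) → (∀ s → Dec (P s)) → Σ (Gen n) P ⊎ (∀ s → ¬ P s)
gen-search P P? with P? affine | FinP.any? (P? ∘ simple)
... | yes p  | _            = inj₁ (affine , p)
... | no  _  | yes (a , p)  = inj₁ (simple a , p)
... | no  ¬p | no  ¬q       = inj₂ λ { affine → ¬p ; (simple a) p → ¬q (a , p) }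

IsLength-unique : ∀ {n} {v : Word n} {m m′} → IsLength v m → IsLength v m′ → m ≡ m′
IsLength-unique ((v₁ , v₁≈v , refl) , minimal₁) ((v₂ , v₂≈v , refl) , minimal₂) =
  ℕP.≤-antisym (minimal₁ v₂ v₂≈v) (minimal₂ v₁ v₁≈v)

length-snoc : ∀ {A : Set} (v : List A) x → length (v ++ [ x ]) ≡ suc (length v)
length-snoc v x = trans (DataListP.length-++ v) (ℕP.+-comm (length v) 1)

module Window (m : ℕ) where

  n : ℕ
  n = suc m

  F : Set
  F = Fin (suc n)

  D : ℕ
  D = twoN n

  L : F
  L = fromℕ n

  -- genAct s unfolds to reflH (rootˡ s) (rootʳ s) (level s).
  rootˡ rootʳ : Gen n → F
  rootˡ (simple a) = inject₁ a
  rootˡ affine     = zero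
  rootʳ (simple a) = suc a
  rootʳ affine     = L

  level : Gen n → ℤ
  level (simple _) = + 0
  level affine     = + 1

  left right : Gen n → F
  left (simple a) = inject₁ a
  left affine     = L
  right (simple a) = suc a
  right affine     = zero

  0≢L : zero ≢ L
  0≢L ()

  0<L : Fin._<_ {suc n} zero L
  0<L = subst (0 ℕ.<_) (sym (FinP.toℕ-fromℕ n)) (ℕ.s≤s ℕ.z≤n)

  rootˡ≢rootʳ : ∀ s → rootˡ s ≢ rootʳ s
  rootˡ≢rootʳ (simple a) = inject₁≢suc a
  rootˡ≢rootʳ affine     = 0≢L

  left≢right : ∀ s → left s ≢ right s
  left≢right (simple a) = inject₁≢suc a
  left≢right affine     = 0≢L ∘ sym

  -- The window of a word

  τ : Gen n → F → F
  τ s = transpose (rootˡ s) (rootʳ s)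

  τ-involutive : ∀ s x → τ s (τ s x) ≡ x
  τ-involutive s = transpose-involutive (rootˡ s) (rootʳ s)

  τ-injective : ∀ s {x y} → x ≢ y → τ s x ≢ τ s y
  τ-injective s x≢y eq = x≢y (trans (sym (τ-involutive s _)) (trans (cong (τ s) eq) (τ-involutive s _)))

  shift : Gen n → F → ℤ
  shift s k = level s * (δ k (rootˡ s) - δ k (rootʳ s))

  genAct-window : ∀ s (μ : Point n) k → genAct s μ k ≡ μ (τ s k) + + D * shift s k
  genAct-window s@(simple _) μ k = reflH-transpose (level s) μ k (rootˡ≢rootʳ s)
  genAct-window s@affine     μ k = reflH-transpose (level s) μ k (rootˡ≢rootʳ s)

  perm : Word n → F → F
  perm []      k = k
  perm (s ∷ v) k = perm v (τ s k)

  perm⁻¹ : Word n → F → F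
  perm⁻¹ []      k = k
  perm⁻¹ (s ∷ v) k = τ s (perm⁻¹ v k)

  offset : Word n → F → ℤ
  offset []      k = + 0
  offset (s ∷ v) k = offset v (τ s k) + shift s k

  act-window : ∀ v (μ : Point n) k → act v μ k ≡ μ (perm v k) + + D * offset v k
  act-window []      μ k = sym (trans (cong (_+_ (μ k)) (ℤP.*-zeroʳ (+ D))) (ℤP.+-identityʳ (μ k)))
  act-window (s ∷ v) μ k = begin
    genAct s (act v μ) k                                         ≡⟨ genAct-window s (act v μ) k ⟩
    act v μ (τ s k) + + D * shift s k                            ≡⟨ cong (_+ + D * shift s k) (act-window v μ (τ s k)) ⟩
    μ (perm v (τ s k)) + + D * offset v (τ s k) + + D * shift s k
      ≡⟨ distribute (μ (perm v (τ s k))) (+ D) (offset v (τ s k)) (shift s k) ⟩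
    μ (perm v (τ s k)) + + D * (offset v (τ s k) + shift s k)    ∎
    where
    open ≡-Reasoning
    distribute : ∀ x d a b → x + d * a + d * b ≡ x + d * (a + b)
    distribute = solve-∀

  perm-perm⁻¹ : ∀ v k → perm v (perm⁻¹ v k) ≡ k
  perm-perm⁻¹ []      k = refl
  perm-perm⁻¹ (s ∷ v) k = trans (cong (perm v) (τ-involutive s (perm⁻¹ v k))) (perm-perm⁻¹ v k)

  perm⁻¹-perm : ∀ v k → perm⁻¹ v (perm v k) ≡ k
  perm⁻¹-perm []      k = refl
  perm⁻¹-perm (s ∷ v) k = trans (cong (τ s) (perm⁻¹-perm v (τ s k))) (τ-involutive s k)

  perm-injective : ∀ v {i j} → perm v i ≡ perm v j → i ≡ j
  perm-injective v {i} {j} eq = trans (sym (perm⁻¹-perm v i)) (trans (cong (perm⁻¹ v) eq) (perm⁻¹-perm v j))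

  perm-snoc : ∀ v s k → perm (v ++ [ s ]) k ≡ τ s (perm v k)
  perm-snoc []      s k = refl
  perm-snoc (g ∷ v) s k = perm-snoc v s (τ g k)

  offset-snoc : ∀ v s k → offset (v ++ [ s ]) k ≡ offset v k + shift s (perm v k)
  offset-snoc []      s k = refl
  offset-snoc (g ∷ v) s k =
    trans (cong (_+ shift g k) (offset-snoc v s (τ g k))) (right-comm (offset v (τ g k)) _ _)
    where
    right-comm : ∀ a b c → a + b + c ≡ a + c + b
    right-comm = solve-∀

  act-++ : ∀ v w (μ : Point n) → act (v ++ w) μ ≡ act v (act w μ)
  act-++ []      w μ = refl
  act-++ (s ∷ v) w μ = cong (genAct s) (act-++ v w μ)

  genAct-involutive : ∀ s (μ : Point n) k → genAct s (genAct s μ) k ≡ μ k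
  genAct-involutive s@(simple _) μ k = reflH-involutive (level s) μ k (rootˡ≢rootʳ s)
  genAct-involutive s@affine     μ k = reflH-involutive (level s) μ k (rootˡ≢rootʳ s)

  act-cong : ∀ v {μ μ′ : Point n} → (∀ k → μ k ≡ μ′ k) → ∀ k → act v μ k ≡ act v μ′ k
  act-cong v {μ} {μ′} μ≗μ′ k =
    trans (act-window v μ k) (trans (cong (_+ + D * offset v k) (μ≗μ′ (perm v k))) (sym (act-window v μ′ k)))

  inverted : F → F → ℕ
  inverted x y = if does (y FinP.<? x) then 1 else 0

  inverted-< : ∀ {x y} → y Fin.< x → inverted x y ≡ 1
  inverted-< {x} {y} y<x rewrite dec-true (y FinP.<? x) y<x = refl

  inverted-≮ : ∀ {x y} → ¬ y Fin.< x → inverted x y ≡ 0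
  inverted-≮ {x} {y} y≮x rewrite dec-false (y FinP.<? x) y≮x = refl

  inverted-irrefl : ∀ x → inverted x x ≡ 0
  inverted-irrefl x = inverted-≮ {x} {x} (ℕP.<-irrefl refl)

  inverted-+-inverted : ∀ {x y} → x ≢ y → + inverted x y + + inverted y x ≡ + 1
  inverted-+-inverted {x} {y} x≢y with FinP.<-cmp x y
  ... | tri< x<y _ y≮x rewrite inverted-≮ y≮x | inverted-< x<y = refl
  ... | tri≈ _ x≡y _   = ⊥-elim (x≢y x≡y)
  ... | tri> x≮y _ y<x rewrite inverted-< y<x | inverted-≮ x≮y = refl

  inverted-flip : ∀ {x y} → x ≢ y → + inverted y x ≡ + 1 - + inverted x y
  inverted-flip {x} {y} x≢y = trans (solve₁ (+ inverted y x) (+ inverted x y)) (cong (_- + inverted x y) (inverted-+-inverted x≢y))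
    where
    solve₁ : ∀ a b → a ≡ (b + a) - b
    solve₁ = solve-∀

  inverted-adjacent : ∀ (a : Fin n) {o} → o ≢ inject₁ a → inverted (suc a) o ≡ inverted (inject₁ a) o
  inverted-adjacent a {o} o≢a with o FinP.<? inject₁ a
  ... | yes o<a = trans (inverted-< (ℕP.<-trans o<a (inject₁<suc a))) (sym (inverted-< o<a))
  ... | no  o≮a = trans (inverted-≮ o≮suc) (sym (inverted-≮ o≮a))
    where
    o≮suc : ¬ o Fin.< suc a
    o≮suc o<suc = o≢a (FinP.toℕ-injective (ℕP.≤-antisym
      (subst (toℕ o ℕ.≤_) (sym (FinP.toℕ-inject₁ a)) (ℕ.s≤s⁻¹ o<suc)) (ℕP.≮⇒≥ o≮a)))

  inverted-L : ∀ {o} → o ≢ L → inverted L o ≡ 1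
  inverted-L {o} o≢L = inverted-< (subst (toℕ o ℕ.<_) (sym (FinP.toℕ-fromℕ n))
    (ℕP.≤∧≢⇒< (FinP.toℕ≤pred[n] o) (λ eq → o≢L (FinP.toℕ-injective (trans eq (sym (FinP.toℕ-fromℕ n)))))))

  inverted-zero : ∀ o → inverted zero o ≡ 0
  inverted-zero o = inverted-≮ {zero} {o} λ ()

  2x<D : ∀ (x : F) → 2 ℕ.* toℕ x ℕ.< D
  2x<D x = ℕP.*-monoʳ-< 2 (FinP.toℕ<n x)

  gap : F → F → ℕ
  gap x y = if does (y FinP.<? x) then D ℕ.+ 2 ℕ.* toℕ y ℕ.∸ 2 ℕ.* toℕ x else 2 ℕ.* toℕ y ℕ.∸ 2 ℕ.* toℕ x

  gap-< : ∀ {x y} → y Fin.< x → gap x y ℕ.+ 2 ℕ.* toℕ x ≡ D ℕ.+ 2 ℕ.* toℕ y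
  gap-< {x} {y} y<x rewrite dec-true (y FinP.<? x) y<x =
    ℕP.m∸n+n≡m (ℕP.≤-trans (ℕP.<⇒≤ (2x<D x)) (ℕP.m≤m+n D _))

  gap-≤ : ∀ {x y} → x Fin.≤ y → gap x y ℕ.+ 2 ℕ.* toℕ x ≡ 2 ℕ.* toℕ y
  gap-≤ {x} {y} x≤y rewrite dec-false (y FinP.<? x) (ℕP.≤⇒≯ x≤y) = ℕP.m∸n+n≡m (ℕP.*-monoʳ-≤ 2 x≤y)

  gap<D : ∀ x y → gap x y ℕ.< D
  gap<D x y with x FinP.≤? y
  ... | yes x≤y = ℕP.≤-<-trans (ℕP.m≤m+n (gap x y) _) (subst (ℕ._< D) (sym (gap-≤ x≤y)) (2x<D y))
  ... | no  x≰y = ℕP.+-cancelʳ-< (2 ℕ.* toℕ x) (gap x y) D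
                    (subst (ℕ._< D ℕ.+ 2 ℕ.* toℕ x) (sym (gap-< y<x)) (ℕP.+-monoʳ-< D (ℕP.*-monoʳ-< 2 y<x)))
    where
    y<x = ℕP.≰⇒> x≰y

  2≤gap : ∀ {x y} → x ≢ y → 2 ℕ.≤ gap x y
  2≤gap {x} {y} x≢y with FinP.<-cmp x y
  ... | tri< x<y _ _ = ℕP.+-cancelʳ-≤ (2 ℕ.* toℕ x) 2 (gap x y)
                         (subst (2 ℕ.+ 2 ℕ.* toℕ x ℕ.≤_) (sym (gap-≤ (ℕP.<⇒≤ x<y)))
                           (subst (ℕ._≤ 2 ℕ.* toℕ y) (ℕP.*-distribˡ-+ 2 1 (toℕ x)) (ℕP.*-monoʳ-≤ 2 x<y)))
  ... | tri≈ _ x≡y _ = ⊥-elim (x≢y x≡y)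
  ... | tri> _ _ y<x = ℕP.+-cancelʳ-≤ (2 ℕ.* toℕ x) 2 (gap x y)
                         (subst (2 ℕ.+ 2 ℕ.* toℕ x ℕ.≤_) (sym (gap-< y<x))
                           (ℕP.≤-trans (subst (ℕ._≤ D) 2[1+x]≡2+2x (ℕP.*-monoʳ-≤ 2 (FinP.toℕ<n x))) (ℕP.m≤m+n D _)))
    where
    2[1+x]≡2+2x : 2 ℕ.* suc (toℕ x) ≡ 2 ℕ.+ 2 ℕ.* toℕ x
    2[1+x]≡2+2x = ℕP.*-distribˡ-+ 2 1 (toℕ x)

  gap-wall : ∀ s → gap (left s) (right s) ≡ 2
  gap-wall (simple a) = ℕP.+-cancelʳ-≡ (2 ℕ.* toℕ (inject₁ a)) (gap (inject₁ a) (suc a)) 2 (begin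
    gap (inject₁ a) (suc a) ℕ.+ 2 ℕ.* toℕ (inject₁ a) ≡⟨ gap-≤ (ℕP.<⇒≤ (inject₁<suc a)) ⟩
    2 ℕ.* suc (toℕ a)                                ≡⟨ cong (λ z → 2 ℕ.* suc z) (sym (FinP.toℕ-inject₁ a)) ⟩
    2 ℕ.* suc (toℕ (inject₁ a))                      ≡⟨ ℕP.*-distribˡ-+ 2 1 (toℕ (inject₁ a)) ⟩
    2 ℕ.+ 2 ℕ.* toℕ (inject₁ a)                      ∎)
    where open ≡-Reasoning
  gap-wall affine = ℕP.+-cancelʳ-≡ (2 ℕ.* toℕ L) (gap L zero) 2 (begin
    gap L zero ℕ.+ 2 ℕ.* toℕ L ≡⟨ gap-< 0<L ⟩
    D ℕ.+ 0                    ≡⟨ ℕP.+-identityʳ D ⟩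
    2 ℕ.* suc n                ≡⟨ ℕP.*-distribˡ-+ 2 1 n ⟩
    2 ℕ.+ 2 ℕ.* n              ≡⟨ cong (λ z → 2 ℕ.+ 2 ℕ.* z) (sym (FinP.toℕ-fromℕ n)) ⟩
    2 ℕ.+ 2 ℕ.* toℕ L          ∎)
    where open ≡-Reasoning

  μ₀-difference : ∀ x y → μ₀ n x - μ₀ n y ≡ + gap x y + (- + inverted x y) * + D
  μ₀-difference x y with x FinP.≤? y
  ... | yes x≤y rewrite inverted-≮ (ℕP.≤⇒≯ x≤y) =
    trans (pos-difference n (gap x y) _ (2 ℕ.* toℕ y) 0 (trans (gap-≤ x≤y) (sym (ℕP.+-identityʳ _)))) (no-wrap (+ gap x y) (+ D))
    where
    no-wrap : ∀ g d → g - + 0 ≡ g + (- + 0) * d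
    no-wrap = solve-∀
  ... | no  x≰y rewrite inverted-< (ℕP.≰⇒> x≰y) =
    trans (pos-difference n (gap x y) _ (2 ℕ.* toℕ y) D (trans (gap-< (ℕP.≰⇒> x≰y)) (ℕP.+-comm D _))) (wrap (+ gap x y) (+ D))
    where
    wrap : ∀ g d → g - d ≡ g + (- + 1) * d
    wrap = solve-∀

  act-difference′ : ∀ v i j → act v (μ₀ n) i - act v (μ₀ n) j ≡
                    + gap (perm v i) (perm v j) + ((offset v i - offset v j) - + inverted (perm v i) (perm v j)) * + D
  act-difference′ v i j = begin
    act v (μ₀ n) i - act v (μ₀ n) j
      ≡⟨ cong₂ _-_ (act-window v (μ₀ n) i) (act-window v (μ₀ n) j) ⟩
    (μ₀ n x + + D * offset v i) - (μ₀ n y + + D * offset v j)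
      ≡⟨ regroup (μ₀ n x) (μ₀ n y) (offset v i) (offset v j) (+ D) ⟩
    (μ₀ n x - μ₀ n y) + (offset v i - offset v j) * + D
      ≡⟨ cong (_+ (offset v i - offset v j) * + D) (μ₀-difference x y) ⟩
    + gap x y + (- + inverted x y) * + D + (offset v i - offset v j) * + D
      ≡⟨ collect (+ gap x y) (+ inverted x y) (offset v i - offset v j) (+ D) ⟩
    + gap x y + ((offset v i - offset v j) - + inverted x y) * + D ∎
    where
    open ≡-Reasoning
    x = perm v i
    y = perm v j
    regroup : ∀ a b s t d → (a + d * s) - (b + d * t) ≡ (a - b) + (s - t) * d
    regroup = solve-∀
    collect : ∀ g c t d → g + (- c) * d + t * d ≡ g + (t - c) * d
    collect = solve-∀

  address-window : ∀ v i j → address v i j ≡ (offset v i - offset v j) - + inverted (perm v i) (perm v j)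
  address-window v i j = [r+q*d]/ℕd≡q _ (gap<D (perm v i) (perm v j)) (act-difference′ v i j)

  act-difference : ∀ v i j → act v (μ₀ n) i - act v (μ₀ n) j ≡ + gap (perm v i) (perm v j) + address v i j * + D
  act-difference v i j =
    trans (act-difference′ v i j) (cong (λ a → + gap (perm v i) (perm v j) + a * + D) (sym (address-window v i j)))

  address-[] : ∀ i j → address [] i j ≡ - + inverted i j
  address-[] i j = trans (address-window [] i j) (ℤP.+-identityˡ _)

  address-antisym : ∀ v {i j} → i ≢ j → address v i j + address v j i ≡ - + 1
  address-antisym v {i} {j} i≢j = begin
    address v i j + address v j i
      ≡⟨ cong₂ _+_ (address-window v i j) (address-window v j i) ⟩
    ((offset v i - offset v j) - + inverted x y) + ((offset v j - offset v i) - + inverted y x)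
      ≡⟨ regroup (offset v i) (offset v j) (+ inverted x y) (+ inverted y x) ⟩
    - (+ inverted x y + + inverted y x)
      ≡⟨ cong -_ (inverted-+-inverted (i≢j ∘ perm-injective v)) ⟩
    - + 1 ∎
    where
    open ≡-Reasoning
    x = perm v i
    y = perm v j
    regroup : ∀ a b c d → ((a - b) - c) + ((b - a) - d) ≡ - (c + d)
    regroup = solve-∀

  μ₀-window-injective : ∀ {x y a b} → μ₀ n x + + D * a ≡ μ₀ n y + + D * b → x ≡ y × a ≡ b
  μ₀-window-injective {x} {y} {a} {b} eq = x≡y , a≡b
    where
    as-multiple : μ₀ n x - μ₀ n y ≡ + 0 + (b - a) * + D
    as-multiple = begin
      μ₀ n x - μ₀ n y                               ≡⟨ expand (μ₀ n x) (μ₀ n y) a (+ D) ⟩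
      (μ₀ n x + + D * a) - μ₀ n y - + D * a          ≡⟨ cong (λ z → z - μ₀ n y - + D * a) eq ⟩
      (μ₀ n y + + D * b) - μ₀ n y - + D * a          ≡⟨ contract (μ₀ n y) a b (+ D) ⟩
      + 0 + (b - a) * + D                           ∎
      where
      open ≡-Reasoning
      expand : ∀ p q a d → p - q ≡ (p + d * a) - q - d * a
      expand = solve-∀
      contract : ∀ q a b d → (q + d * b) - q - d * a ≡ + 0 + (b - a) * d
      contract = solve-∀
    quotients : - + inverted x y ≡ b - a
    quotients = trans (sym ([r+q*d]/ℕd≡q _ (gap<D x y) (μ₀-difference x y))) ([r+q*d]/ℕd≡q 0 (ℕP.0<1+n) as-multiple)
    gap≡0 : gap x y ≡ 0
    gap≡0 = ℤP.+-injective (∙-cancelʳ ((- + inverted x y) * + D) (+ gap x y) (+ 0) (trans (sym (μ₀-difference x y))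
              (trans as-multiple (cong (λ q → + 0 + q * + D) (sym quotients)))))
    x≡y : x ≡ y
    x≡y with x ≟ y
    ... | yes x≡y = x≡y
    ... | no  x≢y = ⊥-elim (ℕP.<⇒≱ (subst (ℕ._< 2) (sym gap≡0) (ℕP.0<1+n)) (2≤gap x≢y))
    a≡b : a ≡ b
    a≡b = sym (ℤP.i-j≡0⇒i≡j b a (trans (sym quotients)
            (cong (λ z → - + z) (trans (cong (inverted x) (sym x≡y)) (inverted-irrefl x)))))

  ≈W⇒same-window : ∀ {v w} → v ≈W w → ∀ k → perm v k ≡ perm w k × offset v k ≡ offset w k
  ≈W⇒same-window {v} {w} v≈w k =
    μ₀-window-injective (trans (sym (act-window v (μ₀ n) k)) (trans (v≈w k) (act-window w (μ₀ n) k)))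

  act-≈W : ∀ {v w} → v ≈W w → ∀ (μ : Point n) k → act v μ k ≡ act w μ k
  act-≈W {v} {w} v≈w μ k with ≈W⇒same-window {v} {w} v≈w k
  ... | perm≡ , offset≡ =
    trans (act-window v μ k) (trans (cong₂ (λ x t → μ x + + D * t) perm≡ offset≡) (sym (act-window w μ k)))

  snoc-cong : ∀ v w s → v ≈W w → (v ++ [ s ]) ≈W (w ++ [ s ])
  snoc-cong v w s v≈w k = begin
    act (v ++ [ s ]) (μ₀ n) k   ≡⟨ cong-app (act-++ v [ s ] (μ₀ n)) k ⟩
    act v (genAct s (μ₀ n)) k   ≡⟨ act-≈W {v} {w} v≈w (genAct s (μ₀ n)) k ⟩
    act w (genAct s (μ₀ n)) k   ≡⟨ cong-app (act-++ w [ s ] (μ₀ n)) k ⟨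
    act (w ++ [ s ]) (μ₀ n) k   ∎
    where open ≡-Reasoning

  snoc-snoc : ∀ v s → ((v ++ [ s ]) ++ [ s ]) ≈W v
  snoc-snoc v s k = begin
    act ((v ++ [ s ]) ++ [ s ]) (μ₀ n) k   ≡⟨ cong-app (act-++ (v ++ [ s ]) [ s ] (μ₀ n)) k ⟩
    act (v ++ [ s ]) (genAct s (μ₀ n)) k   ≡⟨ cong-app (act-++ v [ s ] (genAct s (μ₀ n))) k ⟩
    act v (genAct s (genAct s (μ₀ n))) k   ≡⟨ act-cong v (genAct-involutive s (μ₀ n)) k ⟩
    act v (μ₀ n) k                         ∎
    where open ≡-Reasoning

  address-≈W : ∀ (v w : Word n) → v ≈W w → ∀ i j → address v i j ≡ address w i j
  address-≈W v w v≈w i j = cong (_/ℕ D) (cong₂ _-_ (v≈w i) (v≈w j))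

  -- Appending a generator

  wallChange : Gen n → F → F → ℤ
  wallChange s x y = δ x (right s) * δ y (left s) - δ x (left s) * δ y (right s)

  -- Adding offset v i − offset v j to both sides, with x = perm v i and y = perm v j, turns this into
  -- k_{v s}(i,j) = k_v(i,j) + wallChange s x y.
  InversionLaw : Gen n → F → F → Set
  InversionLaw s x y = shift s x - shift s y - + inverted (τ s x) (τ s y) ≡ wallChange s x y - + inverted x y

  shift-off : ∀ s {x} → x ≢ rootˡ s → x ≢ rootʳ s → shift s x ≡ + 0
  shift-off s x≢ˡ x≢ʳ rewrite δ-off x≢ˡ | δ-off x≢ʳ = ℤP.*-zeroʳ (level s)

  shift-rootˡ : ∀ s → shift s (rootˡ s) ≡ level s * (+ 1 - + 0)
  shift-rootˡ s = cong (λ z → level s * z) (cong₂ _-_ (δ-diag (rootˡ s)) (δ-off (rootˡ≢rootʳ s)))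

  shift-rootʳ : ∀ s → shift s (rootʳ s) ≡ level s * (+ 0 - + 1)
  shift-rootʳ s = cong (λ z → level s * z) (cong₂ _-_ (δ-off (rootˡ≢rootʳ s ∘ sym)) (δ-diag (rootʳ s)))

  wallChange-off : ∀ s {x} y → x ≢ rootˡ s → x ≢ rootʳ s → wallChange s x y ≡ + 0
  wallChange-off (simple _) y x≢ˡ x≢ʳ rewrite δ-off x≢ˡ | δ-off x≢ʳ = refl
  wallChange-off affine     y x≢ˡ x≢ʳ rewrite δ-off x≢ˡ | δ-off x≢ʳ = refl

  wallChange-offʳ : ∀ s x {y} → y ≢ rootˡ s → y ≢ rootʳ s → wallChange s x y ≡ + 0
  wallChange-offʳ (simple a) x y≢ˡ y≢ʳ =
    cong₂ _-_ (trans (cong (δ x (suc a) *_) (δ-off y≢ˡ)) (ℤP.*-zeroʳ (δ x (suc a))))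
              (trans (cong (δ x (inject₁ a) *_) (δ-off y≢ʳ)) (ℤP.*-zeroʳ (δ x (inject₁ a))))
  wallChange-offʳ affine     x y≢ˡ y≢ʳ =
    cong₂ _-_ (trans (cong (δ x zero *_) (δ-off y≢ʳ)) (ℤP.*-zeroʳ (δ x zero)))
              (trans (cong (δ x L *_) (δ-off y≢ˡ)) (ℤP.*-zeroʳ (δ x L)))

  wallChange-left-right : ∀ s → wallChange s (left s) (right s) ≡ - + 1
  wallChange-left-right s =
    cong₂ _-_ (cong₂ _*_ (δ-off (left≢right s)) (δ-off (left≢right s ∘ sym))) (cong₂ _*_ (δ-diag (left s)) (δ-diag (right s)))

  wallChange-right-left : ∀ s → wallChange s (right s) (left s) ≡ + 1
  wallChange-right-left s =
    cong₂ _-_ (cong₂ _*_ (δ-diag (right s)) (δ-diag (left s))) (cong₂ _*_ (δ-off (left≢right s ∘ sym)) (δ-off (left≢right s)))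

  inversionLaw-from : ∀ s x y {c c′ i w i′} → shift s x ≡ c → shift s y ≡ c′ → inverted (τ s x) (τ s y) ≡ i →
                      wallChange s x y ≡ w → inverted x y ≡ i′ → c - c′ - + i ≡ w - + i′ → InversionLaw s x y
  inversionLaw-from s x y c≡ c′≡ i≡ w≡ i′≡ arithmetic =
    trans (cong₂ _-_ (cong₂ _-_ c≡ c′≡) (cong +_ i≡)) (trans arithmetic (sym (cong₂ _-_ w≡ (cong +_ i′≡))))

  inversionLaw-diag : ∀ s x → InversionLaw s x x
  inversionLaw-diag s x rewrite inverted-irrefl x | inverted-irrefl (τ s x) =
    vanish (shift s x) (δ x (right s)) (δ x (left s))
    where
    vanish : ∀ c p q → c - c - + 0 ≡ p * q - q * p - + 0
    vanish = solve-∀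

  inversionLaw-swap : ∀ s {x y} → x ≢ y → InversionLaw s x y → InversionLaw s y x
  inversionLaw-swap s {x} {y} x≢y law = begin
    shift s y - shift s x - + inverted (τ s y) (τ s x)
      ≡⟨ cong (_-_ (shift s y - shift s x)) (inverted-flip (τ-injective s x≢y)) ⟩
    shift s y - shift s x - (+ 1 - + inverted (τ s x) (τ s y))
      ≡⟨ negate (shift s x) (shift s y) (+ inverted (τ s x) (τ s y)) ⟩
    - (shift s x - shift s y - + inverted (τ s x) (τ s y)) - + 1
      ≡⟨ cong (λ z → - z - + 1) law ⟩
    - (wallChange s x y - + inverted x y) - + 1
      ≡⟨ negate′ (δ x (right s)) (δ y (left s)) (δ x (left s)) (δ y (right s)) (+ inverted x y) ⟩
    wallChange s y x - (+ 1 - + inverted x y)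
      ≡⟨ cong (_-_ (wallChange s y x)) (sym (inverted-flip x≢y)) ⟩
    wallChange s y x - + inverted y x ∎
    where
    open ≡-Reasoning
    negate : ∀ a b c → b - a - (+ 1 - c) ≡ - (a - b - c) - + 1
    negate = solve-∀
    negate′ : ∀ p q r t c → - (p * q - r * t - c) - + 1 ≡ t * r - q * p - (+ 1 - c)
    negate′ = solve-∀

  inversionLaw-off : ∀ s {x y} → x ≢ rootˡ s → x ≢ rootʳ s → y ≢ rootˡ s → y ≢ rootʳ s → InversionLaw s x y
  inversionLaw-off s {x} {y} x≢ˡ x≢ʳ y≢ˡ y≢ʳ
    rewrite transpose-off x≢ˡ x≢ʳ | transpose-off y≢ˡ y≢ʳ
          | shift-off s x≢ˡ x≢ʳ | shift-off s y≢ˡ y≢ʳ | wallChange-off s y x≢ˡ x≢ʳ = refl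

  inversionLaw-roots : ∀ s → InversionLaw s (rootˡ s) (rootʳ s)
  inversionLaw-roots s@(simple a) = inversionLaw-from s (inject₁ a) (suc a) (shift-rootˡ s) (shift-rootʳ s)
    (trans (cong₂ inverted (transpose-at₁ (inject₁ a) (suc a)) (transpose-at₂ (inject₁ a) (suc a))) (inverted-< (inject₁<suc a)))
    (wallChange-left-right s) (inverted-≮ (ℕP.<-asym (inject₁<suc a))) refl
  inversionLaw-roots s@affine = inversionLaw-from s zero L (shift-rootˡ s) (shift-rootʳ s)
    (trans (cong₂ inverted (transpose-at₁ zero L) (transpose-at₂ zero L)) (inverted-< 0<L))
    (wallChange-right-left s) (inverted-≮ (ℕP.<-asym 0<L)) refl

  inversionLaw-rootˡ : ∀ s {o} → o ≢ rootˡ s → o ≢ rootʳ s → InversionLaw s (rootˡ s) o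
  inversionLaw-rootˡ s@(simple a) {o} o≢ˡ o≢ʳ = inversionLaw-from s (inject₁ a) o (shift-rootˡ s) (shift-off s o≢ˡ o≢ʳ)
    (trans (cong₂ inverted (transpose-at₁ (inject₁ a) (suc a)) (transpose-off o≢ˡ o≢ʳ)) (inverted-adjacent a o≢ˡ))
    (wallChange-offʳ s (inject₁ a) o≢ˡ o≢ʳ) refl refl
  inversionLaw-rootˡ s@affine {o} o≢ˡ o≢ʳ = inversionLaw-from s zero o (shift-rootˡ s) (shift-off s o≢ˡ o≢ʳ)
    (trans (cong₂ inverted (transpose-at₁ zero L) (transpose-off o≢ˡ o≢ʳ)) (inverted-L o≢ʳ))
    (wallChange-offʳ s zero o≢ˡ o≢ʳ) (inverted-zero o) refl

  inversionLaw-rootʳ : ∀ s {o} → o ≢ rootˡ s → o ≢ rootʳ s → InversionLaw s (rootʳ s) o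
  inversionLaw-rootʳ s@(simple a) {o} o≢ˡ o≢ʳ = inversionLaw-from s (suc a) o (shift-rootʳ s) (shift-off s o≢ˡ o≢ʳ)
    (trans (cong₂ inverted (transpose-at₂ (inject₁ a) (suc a)) (transpose-off o≢ˡ o≢ʳ)) (sym (inverted-adjacent a o≢ˡ)))
    (wallChange-offʳ s (suc a) o≢ˡ o≢ʳ) refl refl
  inversionLaw-rootʳ s@affine {o} o≢ˡ o≢ʳ = inversionLaw-from s L o (shift-rootʳ s) (shift-off s o≢ˡ o≢ʳ)
    (trans (cong₂ inverted (transpose-at₂ zero L) (transpose-off o≢ˡ o≢ʳ)) (inverted-zero o))
    (wallChange-offʳ s L o≢ˡ o≢ʳ) (inverted-L o≢ʳ) refl

  inversionLaw : ∀ s x y → InversionLaw s x y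
  inversionLaw s x y with x ≟ y
  ... | yes refl = inversionLaw-diag s x
  ... | no  x≢y with side (rootˡ s) (rootʳ s) x | side (rootˡ s) (rootʳ s) y
  ...   | at₁ refl    | at₁ refl    = ⊥-elim (x≢y refl)
  ...   | at₁ refl    | at₂ refl    = inversionLaw-roots s
  ...   | at₁ refl    | off y≢ˡ y≢ʳ = inversionLaw-rootˡ s y≢ˡ y≢ʳ
  ...   | at₂ refl    | at₁ refl    = inversionLaw-swap s (rootˡ≢rootʳ s) (inversionLaw-roots s)
  ...   | at₂ refl    | at₂ refl    = ⊥-elim (x≢y refl)
  ...   | at₂ refl    | off y≢ˡ y≢ʳ = inversionLaw-rootʳ s y≢ˡ y≢ʳ
  ...   | off x≢ˡ x≢ʳ | at₁ refl    = inversionLaw-swap s (x≢y ∘ sym) (inversionLaw-rootˡ s x≢ˡ x≢ʳ)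
  ...   | off x≢ˡ x≢ʳ | at₂ refl    = inversionLaw-swap s (x≢y ∘ sym) (inversionLaw-rootʳ s x≢ˡ x≢ʳ)
  ...   | off x≢ˡ x≢ʳ | off y≢ˡ y≢ʳ = inversionLaw-off s x≢ˡ x≢ʳ y≢ˡ y≢ʳ

  address-snoc : ∀ v s i j → address (v ++ [ s ]) i j ≡ address v i j + wallChange s (perm v i) (perm v j)
  address-snoc v s i j = begin
    address (v ++ [ s ]) i j
      ≡⟨ address-window (v ++ [ s ]) i j ⟩
    (offset (v ++ [ s ]) i - offset (v ++ [ s ]) j) - + inverted (perm (v ++ [ s ]) i) (perm (v ++ [ s ]) j)
      ≡⟨ cong₂ (λ a b → a - + b) (cong₂ _-_ (offset-snoc v s i) (offset-snoc v s j))
                                  (cong₂ inverted (perm-snoc v s i) (perm-snoc v s j)) ⟩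
    ((offset v i + shift s x) - (offset v j + shift s y)) - + inverted (τ s x) (τ s y)
      ≡⟨ regroup (offset v i) (offset v j) (shift s x) (shift s y) (+ inverted (τ s x) (τ s y)) ⟩
    (offset v i - offset v j) + (shift s x - shift s y - + inverted (τ s x) (τ s y))
      ≡⟨ cong (_+_ (offset v i - offset v j)) (inversionLaw s x y) ⟩
    (offset v i - offset v j) + (wallChange s x y - + inverted x y)
      ≡⟨ regroup′ (offset v i - offset v j) (wallChange s x y) (+ inverted x y) ⟩
    ((offset v i - offset v j) - + inverted x y) + wallChange s x y
      ≡⟨ cong (_+ wallChange s x y) (sym (address-window v i j)) ⟩
    address v i j + wallChange s x y ∎
    where
    open ≡-Reasoning
    x = perm v i
    y = perm v j
    regroup : ∀ a b c d e → ((a + c) - (b + d)) - e ≡ (a - b) + (c - d - e)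
    regroup = solve-∀
    regroup′ : ∀ t w e → t + (w - e) ≡ (t - e) + w
    regroup′ = solve-∀

  wallˡ wallʳ : Word n → Gen n → F
  wallˡ v s = perm⁻¹ v (left s)
  wallʳ v s = perm⁻¹ v (right s)

  wallˡ≢wallʳ : ∀ v s → wallˡ v s ≢ wallʳ v s
  wallˡ≢wallʳ v s eq = left≢right s (trans (sym (perm-perm⁻¹ v (left s))) (trans (cong (perm v) eq) (perm-perm⁻¹ v (right s))))

  address-snoc-wall : ∀ v s → address (v ++ [ s ]) (wallˡ v s) (wallʳ v s) ≡ address v (wallˡ v s) (wallʳ v s) - + 1
  address-snoc-wall v s = trans (address-snoc v s _ _)
    (cong (_+_ (address v (wallˡ v s) (wallʳ v s)))
          (trans (cong₂ (wallChange s) (perm-perm⁻¹ v (left s)) (perm-perm⁻¹ v (right s))) (wallChange-left-right s)))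

  address-snoc-wall′ : ∀ v s → address (v ++ [ s ]) (wallʳ v s) (wallˡ v s) ≡ address v (wallʳ v s) (wallˡ v s) + + 1
  address-snoc-wall′ v s = trans (address-snoc v s _ _)
    (cong (_+_ (address v (wallʳ v s) (wallˡ v s)))
          (trans (cong₂ (wallChange s) (perm-perm⁻¹ v (right s)) (perm-perm⁻¹ v (left s))) (wallChange-right-left s)))

  address-snoc-elsewhere : ∀ v s i j → ¬ (i ≡ wallˡ v s × j ≡ wallʳ v s) → ¬ (i ≡ wallʳ v s × j ≡ wallˡ v s) →
                           address (v ++ [ s ]) i j ≡ address v i j
  address-snoc-elsewhere v s i j ≢ˡʳ ≢ʳˡ =
    trans (address-snoc v s i j) (trans (cong (_+_ (address v i j)) unchanged) (ℤP.+-identityʳ _))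
    where
    at : ∀ {k} p → perm v k ≡ p → k ≡ perm⁻¹ v p
    at p eq = trans (sym (perm⁻¹-perm v _)) (cong (perm⁻¹ v) eq)
    product-zero : ∀ {x y p q} → ¬ (x ≡ p × y ≡ q) → δ x p * δ y q ≡ + 0
    product-zero {x} {y} {p} {q} ≢pq with x ≟ p | y ≟ q
    ... | yes x≡p | yes y≡q = ⊥-elim (≢pq (x≡p , y≡q))
    ... | yes _   | no  _   = ℤP.*-zeroʳ (+ 1)
    ... | no  _   | _       = refl
    unchanged : wallChange s (perm v i) (perm v j) ≡ + 0
    unchanged = cong₂ _-_ (product-zero λ (x≡ , y≡) → ≢ʳˡ (at _ x≡ , at _ y≡))
                          (product-zero λ (x≡ , y≡) → ≢ˡʳ (at _ x≡ , at _ y≡))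

  address-snoc-cases : ∀ v s i j → (i ≡ wallˡ v s × j ≡ wallʳ v s)
                                 ⊎ (i ≡ wallʳ v s × j ≡ wallˡ v s × address (v ++ [ s ]) i j ≡ address v i j + + 1)
                                 ⊎ address (v ++ [ s ]) i j ≡ address v i j
  address-snoc-cases v s i j with (i ≟ wallˡ v s) ×-dec (j ≟ wallʳ v s) | (i ≟ wallʳ v s) ×-dec (j ≟ wallˡ v s)
  ... | yes at-wall | _              = inj₁ at-wall
  ... | no  _       | yes (refl , refl) = inj₂ (inj₁ (refl , refl , address-snoc-wall′ v s))
  ... | no  ¬XY     | no  ¬YX        = inj₂ (inj₂ (address-snoc-elsewhere v s i j ¬XY ¬YX))

  -- Length

  -- crossing v i j is k_v(i,j) for i < j and −k_v(j,i) for i > j, so Len v = Σ_{i<j} |k_v(i,j)|.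
  crossing : Word n → F → F → ℤ
  crossing v i j = address v i j + + inverted i j

  crossing-< : ∀ v {i j} → i Fin.< j → crossing v i j ≡ address v i j
  crossing-< v {i} {j} i<j = trans (cong (λ z → address v i j + + z) (inverted-≮ (ℕP.<-asym i<j))) (ℤP.+-identityʳ _)

  crossing-antisym : ∀ v {i j} → i ≢ j → crossing v j i ≡ - crossing v i j
  crossing-antisym v {i} {j} i≢j = begin
    address v j i + + inverted j i
      ≡⟨ solve₁ (address v i j) (address v j i) (+ inverted i j) (+ inverted j i) ⟩
    - (address v i j + + inverted i j) + ((address v i j + address v j i) + (+ inverted i j + + inverted j i))
      ≡⟨ cong₂ (λ a b → - (address v i j + + inverted i j) + (a + b)) (address-antisym v i≢j) (inverted-+-inverted i≢j) ⟩
    - (address v i j + + inverted i j) + (- + 1 + + 1)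
      ≡⟨ ℤP.+-identityʳ _ ⟩
    - (address v i j + + inverted i j) ∎
    where
    open ≡-Reasoning
    solve₁ : ∀ a b c d → b + d ≡ - (a + c) + ((a + b) + (c + d))
    solve₁ = solve-∀

  crossing-[] : ∀ i j → crossing [] i j ≡ + 0
  crossing-[] i j = trans (cong (_+ + inverted i j) (address-[] i j)) (ℤP.+-inverseˡ (+ inverted i j))

  crossing-snoc-wall : ∀ v s → crossing (v ++ [ s ]) (wallˡ v s) (wallʳ v s) ≡ crossing v (wallˡ v s) (wallʳ v s) - + 1
  crossing-snoc-wall v s =
    trans (cong (_+ + inverted X Y) (address-snoc-wall v s)) (right-comm (address v X Y) (- + 1) (+ inverted X Y))
    where
    X = wallˡ v s
    Y = wallʳ v s
    right-comm : ∀ a b c → a + b + c ≡ a + c + b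
    right-comm = solve-∀

  crossing-snoc-wall′ : ∀ v s → crossing (v ++ [ s ]) (wallʳ v s) (wallˡ v s) ≡ - (crossing v (wallˡ v s) (wallʳ v s) - + 1)
  crossing-snoc-wall′ v s = begin
    address (v ++ [ s ]) Y X + + inverted Y X   ≡⟨ cong (_+ + inverted Y X) (address-snoc-wall′ v s) ⟩
    address v Y X + + 1 + + inverted Y X        ≡⟨ right-comm (address v Y X) (+ 1) (+ inverted Y X) ⟩
    crossing v Y X + + 1                        ≡⟨ cong (_+ + 1) (crossing-antisym v (wallˡ≢wallʳ v s)) ⟩
    - crossing v X Y + + 1                      ≡⟨ negate (crossing v X Y) ⟩
    - (crossing v X Y - + 1)                    ∎
    where
    open ≡-Reasoning
    X = wallˡ v s
    Y = wallʳ v s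
    right-comm : ∀ a b c → a + b + c ≡ a + c + b
    right-comm = solve-∀
    negate : ∀ e → - e + + 1 ≡ - (e - + 1)
    negate = solve-∀

  Len : Word n → ℕ
  Len v = Σℕ.sum (λ i → Σℕ.sum (λ j → posPart (crossing v i j)))

  Len-snoc : ∀ v s → Len (v ++ [ s ]) ℕ.+ ℤ.∣ crossing v (wallˡ v s) (wallʳ v s) ∣
                   ≡ Len v ℕ.+ ℤ.∣ crossing v (wallˡ v s) (wallʳ v s) - + 1 ∣
  Len-snoc v s = begin
    Len (v ++ [ s ]) ℕ.+ ℤ.∣ e ∣
      ≡⟨ cong (Len (v ++ [ s ]) ℕ.+_)
              (trans (cong (λ z → posPart e ℕ.+ posPart z) (crossing-antisym v X≢Y)) (posPart-pair e)) ⟨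
    Len (v ++ [ s ]) ℕ.+ (posPart e ℕ.+ posPart (crossing v Y X))
      ≡⟨ sum₂-update (λ i j → posPart (crossing (v ++ [ s ]) i j)) (λ i j → posPart (crossing v i j)) X≢Y unchanged ⟩
    Len v ℕ.+ (posPart (crossing (v ++ [ s ]) X Y) ℕ.+ posPart (crossing (v ++ [ s ]) Y X))
      ≡⟨ cong (Len v ℕ.+_) (trans (cong₂ (λ a b → posPart a ℕ.+ posPart b) (crossing-snoc-wall v s) (crossing-snoc-wall′ v s))
                                  (posPart-pair (e - + 1))) ⟩
    Len v ℕ.+ ℤ.∣ e - + 1 ∣ ∎
    where
    open ≡-Reasoning
    X = wallˡ v s
    Y = wallʳ v s
    X≢Y = wallˡ≢wallʳ v s
    e = crossing v X Y
    unchanged : ∀ i j → ¬ (i ≡ X × j ≡ Y) → ¬ (i ≡ Y × j ≡ X) →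
                posPart (crossing (v ++ [ s ]) i j) ≡ posPart (crossing v i j)
    unchanged i j ≢XY ≢YX = cong (λ a → posPart (a + + inverted i j)) (address-snoc-elsewhere v s i j ≢XY ≢YX)

  Len-descent : ∀ v s → + 1 ℤ.≤ crossing v (wallˡ v s) (wallʳ v s) → suc (Len (v ++ [ s ])) ≡ Len v
  Len-descent v s 1≤e = ∣e-1∣-descent _ 1≤e (Len-snoc v s)

  Len-ascent : ∀ v s → crossing v (wallˡ v s) (wallʳ v s) ℤ.≤ + 0 → Len (v ++ [ s ]) ≡ suc (Len v)
  Len-ascent v s e≤0 = ∣e-1∣-ascent _ e≤0 (Len-snoc v s)

  Len-snoc-≤ : ∀ v s → Len (v ++ [ s ]) ℕ.≤ suc (Len v)
  Len-snoc-≤ v s with + 1 ℤP.≤? crossing v (wallˡ v s) (wallʳ v s)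
  ... | yes 1≤e = ℕP.≤-trans (ℕP.n≤1+n _) (ℕP.≤-trans (ℕP.≤-reflexive (Len-descent v s 1≤e)) (ℕP.n≤1+n _))
  ... | no  1≰e = ℕP.≤-reflexive (Len-ascent v s (≰1⇒≤0 1≰e))

  Len-≈W : ∀ v w → v ≈W w → Len v ≡ Len w
  Len-≈W v w v≈w = Σℕ.sum-cong-≗ {x = row v} {y = row w} (λ i → Σℕ.sum-cong-≗ {x = entry v i} {y = entry w i}
    (λ j → cong (λ a → posPart (a + + inverted i j)) (address-≈W v w v≈w i j)))
    where
    entry : Word n → F → F → ℕ
    entry v i j = posPart (crossing v i j)
    row : Word n → F → ℕ
    row v i = Σℕ.sum (entry v i)

  Len-[] : Len [] ≡ 0
  Len-[] = trans (Σℕ.sum-cong-≗ {x = λ i → Σℕ.sum (λ j → posPart (crossing [] i j))} {y = λ _ → 0} row-zero)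
                 (Σℕ.sum-replicate-zero (suc n))
    where
    row-zero : ∀ i → Σℕ.sum (λ j → posPart (crossing [] i j)) ≡ 0
    row-zero i = trans (Σℕ.sum-cong-≗ {x = λ j → posPart (crossing [] i j)} {y = λ _ → 0} (λ j → cong posPart (crossing-[] i j)))
                       (Σℕ.sum-replicate-zero (suc n))

  -- Rigidity

  sum-act : ∀ v (μ : Point n) → sum (act v μ) ≡ sum μ
  sum-act []      μ = refl
  sum-act (s@(simple _) ∷ v) μ = trans (sum-reflH (rootˡ s) (rootʳ s) (level s) (act v μ)) (sum-act v μ)
  sum-act (s@affine ∷ v)     μ = trans (sum-reflH (rootˡ s) (rootʳ s) (level s) (act v μ)) (sum-act v μ)

  wall-gap-≤ : ∀ u w s → address w (wallˡ w s) (wallʳ w s) ℤ.≤ address u (wallˡ w s) (wallʳ w s) →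
               act w (μ₀ n) (wallˡ w s) - act w (μ₀ n) (wallʳ w s) ℤ.≤ act u (μ₀ n) (wallˡ w s) - act u (μ₀ n) (wallʳ w s)
  wall-gap-≤ u w s aw≤au = begin
    act w (μ₀ n) X - act w (μ₀ n) Y                   ≡⟨ act-difference w X Y ⟩
    + gap (perm w X) (perm w Y) + address w X Y * + D  ≡⟨ cong (λ g → + g + address w X Y * + D) gap-w ⟩
    + 2 + address w X Y * + D                          ≤⟨ ℤP.+-mono-≤ (ℤ.+≤+ (2≤gap (X≢Y ∘ perm-injective u)))
                                                                      (ℤP.*-monoʳ-≤-nonNeg (+ D) aw≤au) ⟩
    + gap (perm u X) (perm u Y) + address u X Y * + D  ≡⟨ act-difference u X Y ⟨
    act u (μ₀ n) X - act u (μ₀ n) Y                   ∎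
    where
    open ℤP.≤-Reasoning
    X = wallˡ w s
    Y = wallʳ w s
    X≢Y = wallˡ≢wallʳ w s
    gap-w : gap (perm w X) (perm w Y) ≡ 2
    gap-w = trans (cong₂ gap (perm-perm⁻¹ w (left s)) (perm-perm⁻¹ w (right s))) (gap-wall s)

  -- h weakly decreases along 0 → 1 → ⋯ → L and h 0 ≤ h L, so it is constant; equal coordinate sums make it 0.
  rigidity : ∀ u w → (∀ s → address w (wallˡ w s) (wallʳ w s) ℤ.≤ address u (wallˡ w s) (wallʳ w s)) → u ≈W w
  rigidity u w walls k = trans (Q≡P+κ k) (trans (cong (_+_ (P k)) κ≡0) (ℤP.+-identityʳ (P k)))
    where
    Q P : F → ℤ
    Q = act u (μ₀ n)
    P = act w (μ₀ n)
    h : F → ℤ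
    h b = Q (perm⁻¹ w b) - P (perm⁻¹ w b)
    descends : ∀ s → h (right s) ℤ.≤ h (left s)
    descends s = -‿swap-≤ (Q (wallˡ w s)) (Q (wallʳ w s)) (P (wallˡ w s)) (P (wallʳ w s)) (wall-gap-≤ u w s (walls s))
    h-constant : ∀ b → h b ≡ h zero
    h-constant = cycle-constant h (descends ∘ simple) (descends affine)
    add-back : ∀ q p → q ≡ p + (q - p)
    add-back = solve-∀
    Q≡P+κ : ∀ k → Q k ≡ P k + h zero
    Q≡P+κ k = trans (add-back (Q k) (P k))
      (cong (_+_ (P k)) (trans (cong (λ b → Q b - P b) (sym (perm⁻¹-perm w k))) (h-constant (perm w k))))
    κ≡0 : h zero ≡ + 0
    κ≡0 = translate-sum-invariant P (h zero)
      (trans (sym (Σℤ.sum-cong-≗ Q≡P+κ)) (trans (sum-act u (μ₀ n)) (sym (sum-act w (μ₀ n)))))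

  descent : ∀ v → Σ (Gen n) (λ s → suc (Len (v ++ [ s ])) ≡ Len v) ⊎ [] ≈W v
  descent v with gen-search (λ s → + 1 ℤ.≤ crossing v (wallˡ v s) (wallʳ v s))
                            (λ s → + 1 ℤP.≤? crossing v (wallˡ v s) (wallʳ v s))
  ... | inj₁ (s , 1≤e) = inj₁ (s , Len-descent v s 1≤e)
  ... | inj₂ none      = inj₂ (rigidity [] v λ s →
          subst (address v (wallˡ v s) (wallʳ v s) ℤ.≤_) (sym (address-[] (wallˡ v s) (wallʳ v s))) (+≤0⇒≤- (≰1⇒≤0 (none s))))

  reduced-word : ∀ k v → Len v ≡ k → Σ (Word n) λ v′ → (v′ ≈W v) × (length v′ ≡ k)
  reduced-word k v Lv≡k with descent v
  reduced-word zero    v _    | inj₂ []≈v = [] , []≈v , refl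
  reduced-word (suc k) v Lv≡k | inj₂ []≈v = ⊥-elim (ℕP.0≢1+n (trans (sym Len-[]) (trans (Len-≈W [] v []≈v) Lv≡k)))
  reduced-word zero    v Lv≡0 | inj₁ (s , eq) = ⊥-elim (ℕP.1+n≢0 (trans eq Lv≡0))
  reduced-word (suc k) v Lv≡k | inj₁ (s , eq) with reduced-word k (v ++ [ s ]) (ℕP.suc-injective (trans eq Lv≡k))
  ... | v′ , v′≈vs , length≡k = v′ ++ [ s ] , (λ i → trans (snoc-cong v′ (v ++ [ s ]) s v′≈vs i) (snoc-snoc v s i)) ,
                                trans (length-snoc v′ s) (cong suc length≡k)

  Len-≤-length : ∀ v → Len v ℕ.≤ length v
  Len-≤-length v = go (reverseView v)
    where
    go : ∀ {v} → Reverse v → Len v ℕ.≤ length v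
    go []             = ℕP.≤-reflexive Len-[]
    go (v ∶ rv ∶ʳ s) = ℕP.≤-trans (Len-snoc-≤ v s) (subst (suc (Len v) ℕ.≤_) (sym (length-snoc v s)) (ℕ.s≤s (go rv)))

  Len-isLength : ∀ v → IsLength v (Len v)
  Len-isLength v =
    reduced-word (Len v) v refl , λ v′ v′≈v → subst (ℕ._≤ length v′) (Len-≈W v′ v v′≈v) (Len-≤-length v′)

  -- Weak order

  Dominant : Word n → Set
  Dominant u = ∀ i j → i Fin.< j → + 0 ℤ.≤ address u i j

  infix 4 _≼_
  _≼_ : Word n → Word n → Set
  u ≼ w = ∀ i j → i Fin.< j → address u i j ℤ.≤ address w i j

  -- A step that does not shorten the word crosses a wall with crossing ≤ 0, lowering only addresses ≤ 0.
  step-keeps-positive : ∀ v v′ → WeakStep v v′ → ∀ {i j} → i Fin.< j →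
                        + 1 ℤ.≤ address v i j → address v i j ℤ.≤ address v′ i j
  step-keeps-positive v v′ (s , v′≈vs , m , m′ , ℓv , ℓv′ , m<m′) {i} {j} i<j 1≤a
    with + 1 ℤP.≤? crossing v (wallˡ v s) (wallʳ v s)
  ... | yes 1≤e = ⊥-elim (ℕP.<-asym longer (ℕP.≤-reflexive (Len-descent v s 1≤e)))
    where
    longer : Len v ℕ.< Len (v ++ [ s ])
    longer = subst₂ ℕ._<_ (IsLength-unique {v = v} ℓv (Len-isLength v))
                          (trans (IsLength-unique {v = v′} ℓv′ (Len-isLength v′)) (Len-≈W v′ (v ++ [ s ]) v′≈vs)) m<m′
  ... | no  1≰e = subst (address v i j ℤ.≤_) (sym (address-≈W v′ (v ++ [ s ]) v′≈vs i j)) grows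
    where
    grows : address v i j ℤ.≤ address (v ++ [ s ]) i j
    grows with address-snoc-cases v s i j
    ... | inj₁ (refl , refl)       = ⊥-elim (1≰e (subst (+ 1 ℤ.≤_) (sym (crossing-< v i<j)) 1≤a))
    ... | inj₂ (inj₁ (_ , _ , eq)) = subst (address v i j ℤ.≤_) (sym eq) (ℤP.i≤i+j (address v i j) (+ 1))
    ... | inj₂ (inj₂ eq)           = ℤP.≤-reflexive (sym eq)

  positive-address-mono : ∀ u v → Star WeakStep u v → ∀ {i j} → i Fin.< j →
                          + 1 ℤ.≤ address u i j → address u i j ℤ.≤ address v i j
  positive-address-mono u .u ε i<j 1≤a = ℤP.≤-refl
  positive-address-mono u v (_◅_ {j = u′} step steps) i<j 1≤a =
    ℤP.≤-trans u≤u′ (positive-address-mono u′ v steps i<j (ℤP.≤-trans 1≤a u≤u′))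
    where
    u≤u′ = step-keeps-positive u u′ step i<j 1≤a

  ≤W⇒≼ : ∀ u w → Dominant w → u ≤W w → u ≼ w
  ≤W⇒≼ u w w≥0 (v , steps , v≈w) i j i<j with + 1 ℤP.≤? address u i j
  ... | yes 1≤a = subst (address u i j ℤ.≤_) (address-≈W v w v≈w i j) (positive-address-mono u v steps i<j 1≤a)
  ... | no  1≰a = ℤP.≤-trans (≰1⇒≤0 1≰a) (w≥0 i j i<j)

  address-≤-flip : ∀ u w {i j} → i ≢ j → address u j i ℤ.≤ address w j i → address w i j ℤ.≤ address u i j
  address-≤-flip u w {i} {j} i≢j le =
    subst₂ ℤ._≤_ (sym (flip w)) (sym (flip u)) (ℤP.+-monoʳ-≤ (- + 1) (ℤP.neg-mono-≤ le))
    where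
    solve₁ : ∀ a b → a ≡ (b + a) - b
    solve₁ = solve-∀
    flip : ∀ v → address v i j ≡ - + 1 - address v j i
    flip v = trans (solve₁ (address v i j) (address v j i)) (cong (_- address v j i) (address-antisym v (i≢j ∘ sym)))

  ≤W-extend : ∀ u w s → u ≤W w → Len w ℕ.< Len (w ++ [ s ]) → u ≤W (w ++ [ s ])
  ≤W-extend u w s (v , steps , v≈w) longer = v ++ [ s ] , steps ◅◅ (step ◅ ε) , snoc-cong v w s v≈w
    where
    step : WeakStep v (v ++ [ s ])
    step = s , (λ _ → refl) , Len v , Len (v ++ [ s ]) , Len-isLength v , Len-isLength (v ++ [ s ]) ,
           subst₂ ℕ._<_ (Len-≈W w v (λ k → sym (v≈w k)))
                        (Len-≈W (w ++ [ s ]) (v ++ [ s ]) (λ k → sym (snoc-cong v w s v≈w k))) longer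

  ≤W-≈W : ∀ (u w w′ : Word n) → u ≤W w → w ≈W w′ → u ≤W w′
  ≤W-≈W u w w′ (v , steps , v≈w) w≈w′ = v , steps , λ k → trans (v≈w k) (w≈w′ k)

  SeparatingWall : Word n → Word n → Gen n → Set
  SeparatingWall u w s = wallˡ w s Fin.< wallʳ w s × address u (wallˡ w s) (wallʳ w s) ℤ.< address w (wallˡ w s) (wallʳ w s)

  separating-wall? : ∀ u w → Σ (Gen n) (SeparatingWall u w) ⊎ (∀ s → ¬ SeparatingWall u w s)
  separating-wall? u w = gen-search (SeparatingWall u w) λ s →
    (wallˡ w s FinP.<? wallʳ w s) ×-dec (address u (wallˡ w s) (wallʳ w s) ℤP.<? address w (wallˡ w s) (wallʳ w s))

  no-separating-wall⇒≈W : ∀ u w → u ≼ w → (∀ s → ¬ SeparatingWall u w s) → u ≈W w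
  no-separating-wall⇒≈W u w u≤w none = rigidity u w wall-≤
    where
    wall-≤ : ∀ s → address w (wallˡ w s) (wallʳ w s) ℤ.≤ address u (wallˡ w s) (wallʳ w s)
    wall-≤ s with FinP.<-cmp (wallˡ w s) (wallʳ w s)
    ... | tri< X<Y _ _ = ℤP.≮⇒≥ (λ a<b → none s (X<Y , a<b))
    ... | tri≈ _ X≡Y _ = ⊥-elim (wallˡ≢wallʳ w s X≡Y)
    ... | tri> _ _ Y<X = address-≤-flip u w (wallˡ≢wallʳ w s) (u≤w _ _ Y<X)

  separating-wall-descent : ∀ u w s → Dominant u → SeparatingWall u w s →
                            suc (Len (w ++ [ s ])) ≡ Len w
  separating-wall-descent u w s u≥0 (X<Y , a<b) = Len-descent w s (subst (+ 1 ℤ.≤_) (sym (crossing-< w X<Y))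
    (ℤP.≤-trans (ℤP.+-monoʳ-≤ (+ 1) (u≥0 _ _ X<Y)) (ℤP.i<j⇒suc[i]≤j a<b)))

  separating-wall-≼ : ∀ u w s → u ≼ w → SeparatingWall u w s → u ≼ (w ++ [ s ])
  separating-wall-≼ u w s u≤w (X<Y , a<b) i j i<j with address-snoc-cases w s i j
  ... | inj₁ (refl , refl)      = subst (address u i j ℤ.≤_) (sym (address-snoc-wall w s)) (<⇒≤pred a<b)
  ... | inj₂ (inj₁ (refl , refl , _)) = ⊥-elim (ℕP.<-asym i<j X<Y)
  ... | inj₂ (inj₂ eq)          = subst (address u i j ℤ.≤_) (sym eq) (u≤w i j i<j)

  ≼⇒≤W : ∀ k u w → Len w ≡ k → Dominant u → u ≼ w → u ≤W w
  ≼⇒≤W k u w Lw≡k u≥0 u≤w with separating-wall? u w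
  ... | inj₂ none = u , ε , no-separating-wall⇒≈W u w u≤w none
  ≼⇒≤W zero    u w Lw≡0 u≥0 u≤w | inj₁ (s , wall) =
    ⊥-elim (ℕP.1+n≢0 (trans (separating-wall-descent u w s u≥0 wall) Lw≡0))
  ≼⇒≤W (suc k) u w Lw≡k u≥0 u≤w | inj₁ (s , wall) =
    ≤W-≈W u ((w ++ [ s ]) ++ [ s ]) w (≤W-extend u (w ++ [ s ]) s u≤ws longer) (snoc-snoc w s)
    where
    shorter : suc (Len (w ++ [ s ])) ≡ Len w
    shorter = separating-wall-descent u w s u≥0 wall
    u≤ws : u ≤W (w ++ [ s ])
    u≤ws = ≼⇒≤W k u (w ++ [ s ]) (ℕP.suc-injective (trans shorter Lw≡k)) u≥0 (separating-wall-≼ u w s u≤w wall)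
    longer : Len (w ++ [ s ]) ℕ.< Len ((w ++ [ s ]) ++ [ s ])
    longer = subst (Len (w ++ [ s ]) ℕ.<_) (trans shorter (sym (Len-≈W ((w ++ [ s ]) ++ [ s ]) w (snoc-snoc w s)))) ℕP.≤-refl

corollary5p21 : (n : ℕ) → 1 Data.Nat.≤ n → (u w : Word n)
    → (∀ (i j : Fin (suc n)) → i <F j → + 0 ≤ℤ address u i j)
    → (∀ (i j : Fin (suc n)) → i <F j → + 0 ≤ℤ address w i j)
    → (u ≤W w) ⇔ (∀ (i j : Fin (suc n)) → i <F j → address u i j ≤ℤ address w i j)
corollary5p21 zero    ()
corollary5p21 (suc m) _  u w u≥0 w≥0 =
  mk⇔ (Window.≤W⇒≼ m u w w≥0) (Window.≼⇒≤W m _ u w refl u≥0)
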